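{- Let $N \equiv 2 \pmod 4$ and let $\lambda = (\lambda_1^{m_1}\lambda_2^{m_2})$ be a partition of $N$ into exactly two part sizes $\lambda_1>\lambda_2$ with multiplicities $m_1,m_2\ge 1$. Then the parity class of $\lambda$ is one of $OOOO$, $EOOE$, $EEOE$, $EOEO$, $OEEE$, $EEEO$, $EOEE$, $OEOE$, $OEEO$. Furthermore, if $\lambda$ is not in the class $OOOO$, then exactly one of the two products $\lambda_1 m_1$, $\lambda_2 m_2$ is congruent to $2 \pmod 4$ and the other is congruent to $0 \pmod 4$.
   Context: A partition with exactly two part sizes is written $(\lambda_1^{m_1}\lambda_2^{m_2})$ with $\lambda_1>\lambda_2\ge1$ the part sizes and $m_1,m_2\ge1$ their multiplicities, so it partitions $\lambda_1m_1+\lambda_2m_2$. Its parity class is the word $ABCD$ over $\{O,E\}$ where $A,B,C,D$ record whether $\lambda_1, m_1, \lambda_2, m_2$ respectively are odd ($O$) or even ($E$). -}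

module Defs where

open import Data.Nat using (ℕ; _+_; _*_; _%_; _>_; _≥_)
open import Data.Product using (_×_; _,_)
open import Data.Sum using (_⊎_)
open import Data.List using (List; _∷_; [])
open import Data.List.Membership.Propositional using (_∈_)
open import Relation.Binary.PropositionalEquality using (_≡_)

data Parity : Set where
  O E : Parity

parity : ℕ → Parity
parity n with n % 2
... | 0 = E
... | _ = O

record TwoPartPartition : Set where
  constructor twoPart
  field
    l₁ m₁ l₂ m₂ : ℕ
    l₁>l₂ : l₁ > l₂
    l₂≥1  : l₂ ≥ 1
    m₁≥1  : m₁ ≥ 1
    m₂≥1  : m₂ ≥ 1

open TwoPartPartition public

size : TwoPartPartition → ℕ
size p = l₁ p * m₁ p + l₂ p * m₂ p

ParityClass : Set
ParityClass = Parity × Parity × Parity × Parity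

parityClass : TwoPartPartition → ParityClass
parityClass p = parity (l₁ p) , parity (m₁ p) , parity (l₂ p) , parity (m₂ p)

allowedClasses : List ParityClass
allowedClasses =
  (O , O , O , O) ∷ (E , O , O , E) ∷ (E , E , O , E) ∷ (E , O , E , O) ∷
  (O , E , E , E) ∷ (E , E , E , O) ∷ (E , O , E , E) ∷ (O , E , O , E) ∷
  (O , E , E , O) ∷ []

{-# OPTIONS --safe #-}
module Submission where

-- Put x = λ₁m₁ and y = λ₂m₂, so x + y ≡ 2 (mod 4). Either x and y are both odd, and then
-- so are all four factors (class OOOO), or {x mod 4, y mod 4} = {2, 0}. A product ≡ 2
-- (mod 4) has exactly one even factor, and a product ≡ 0 (mod 4) at least one; the eight
-- other allowed classes are exactly the parity words compatible with this.

open import Defs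
open import Data.Nat using (ℕ; zero; suc; _+_; _*_; _%_; _<_; NonZero; s≤s)
open import Data.Nat.Properties using (*-identityˡ)
open import Data.Nat.DivMod using (m%n<n; %-distribˡ-+; %-distribˡ-*; m∣n⇒o%n%m≡o%m)
open import Data.Nat.Divisibility using (_∣_; divides; ∣-refl; *-pres-∣; m%n≡0⇒n∣m; n∣m⇒m%n≡0)
open import Data.Product using (_×_; _,_)
open import Data.Product.Properties using (≡-dec)
open import Data.Sum using (_⊎_; inj₁; inj₂)
open import Data.List.Membership.Propositional using (_∈_)
open import Data.List.Relation.Unary.Any using (here)
open import Relation.Nullary using (yes; no; contradiction)
open import Relation.Nullary.Decidable using (True; toWitness)
open import Relation.Binary.Definitions using (DecidableEquality)
open import Relation.Binary.PropositionalEquality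
  using (_≡_; _≢_; refl; sym; trans; cong; cong₂; subst; module ≡-Reasoning)

open ≡-Reasoning

parity-cong : ∀ m n → m % 2 ≡ n % 2 → parity m ≡ parity n
parity-cong m n eq with m % 2 | n % 2
parity-cong m n refl | zero  | .zero    = refl
parity-cong m n refl | suc _ | .(suc _) = refl

parity≡E⇒2∣ : ∀ n → parity n ≡ E → 2 ∣ n
parity≡E⇒2∣ n eq with n % 2 in n%2≡r
parity≡E⇒2∣ n refl | zero  = m%n≡0⇒n∣m n 2 n%2≡r
parity≡E⇒2∣ n ()   | suc _

parity-% : ∀ n k .{{_ : NonZero k}} → 2 ∣ k → parity (n % k) ≡ parity n
parity-% n k 2∣k = parity-cong (n % k) n (m∣n⇒o%n%m≡o%m 2 k n 2∣k)

parity-%4 : ∀ n {r} → n % 4 ≡ r → parity n ≡ parity r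
parity-%4 n eq = trans (sym (parity-% n 4 (divides 2 refl))) (cong parity eq)

infixl 7 _*ᵖ_

_*ᵖ_ : Parity → Parity → Parity
O *ᵖ q = q
E *ᵖ _ = E

parity-* : ∀ m n → parity (m * n) ≡ parity m *ᵖ parity n
parity-* m n = begin
  parity (m * n)                   ≡⟨ parity-cong (m * n) (m % 2 * (n % 2)) (%-distribˡ-* m n 2) ⟩
  parity (m % 2 * (n % 2))         ≡⟨ parity-*-residue (n % 2) (m%n<n m 2) ⟩
  parity (m % 2) *ᵖ parity (n % 2) ≡⟨ cong₂ _*ᵖ_ (parity-% m 2 ∣-refl) (parity-% n 2 ∣-refl) ⟩
  parity m *ᵖ parity n             ∎
  where
  parity-*-residue : ∀ {r} s → r < 2 → parity (r * s) ≡ parity r *ᵖ parity s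
  parity-*-residue {0} s _ = refl
  parity-*-residue {1} s _ = cong parity (*-identityˡ s)
  parity-*-residue {suc (suc _)} s (s≤s (s≤s ()))

data OneEven : Parity → Parity → Set where
  oddEven : OneEven O E
  evenOdd : OneEven E O

data NotBothOdd : Parity → Parity → Set where
  oneEven  : ∀ {p q} → OneEven p q → NotBothOdd p q
  bothEven : NotBothOdd E E

odd-product⇒odd-factors : ∀ m n → parity (m * n) ≡ O → parity m ≡ O × parity n ≡ O
odd-product⇒odd-factors m n odd = *ᵖ≡O (trans (sym (parity-* m n)) odd)
  where
  *ᵖ≡O : ∀ {p q} → p *ᵖ q ≡ O → p ≡ O × q ≡ O
  *ᵖ≡O {O} {O} _ = refl , refl
  *ᵖ≡O {O} {E} ()
  *ᵖ≡O {E} ()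

even-product⇒NotBothOdd : ∀ m n → parity (m * n) ≡ E → NotBothOdd (parity m) (parity n)
even-product⇒NotBothOdd m n even = *ᵖ≡E (trans (sym (parity-* m n)) even)
  where
  *ᵖ≡E : ∀ {p q} → p *ᵖ q ≡ E → NotBothOdd p q
  *ᵖ≡E {O} {O} ()
  *ᵖ≡E {O} {E} _ = oneEven oddEven
  *ᵖ≡E {E} {O} _ = oneEven evenOdd
  *ᵖ≡E {E} {E} _ = bothEven

m*n%4≡0⇒NotBothOdd : ∀ m n → (m * n) % 4 ≡ 0 → NotBothOdd (parity m) (parity n)
m*n%4≡0⇒NotBothOdd m n h = even-product⇒NotBothOdd m n (parity-%4 (m * n) h)

m*n%4≡2⇒OneEven : ∀ m n → (m * n) % 4 ≡ 2 → OneEven (parity m) (parity n)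
m*n%4≡2⇒OneEven m n h
  with parity m in m-even | parity n in n-even | even-product⇒NotBothOdd m n (parity-%4 (m * n) h)
... | _ | _ | oneEven one = one
... | E | E | bothEven   = contradiction (trans (sym mn%4≡0) h) λ ()
  where
  mn%4≡0 : (m * n) % 4 ≡ 0
  mn%4≡0 = n∣m⇒m%n≡0 (m * n) 4 (*-pres-∣ (parity≡E⇒2∣ m m-even) (parity≡E⇒2∣ n n-even))

data Sum≡2Mod4 (x y : ℕ) : Set where
  two+zero : x % 4 ≡ 2 → y % 4 ≡ 0 → Sum≡2Mod4 x y
  zero+two : x % 4 ≡ 0 → y % 4 ≡ 2 → Sum≡2Mod4 x y
  odd+odd  : parity x ≡ O → parity y ≡ O → Sum≡2Mod4 x y

sum≡2Mod4 : ∀ x y → (x + y) % 4 ≡ 2 → Sum≡2Mod4 x y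
sum≡2Mod4 x y h =
  residues (x % 4) (y % 4) (m%n<n x 4) (m%n<n y 4) refl refl (trans (sym (%-distribˡ-+ x y 4)) h)
  where
  residues : ∀ r s → r < 4 → s < 4 → x % 4 ≡ r → y % 4 ≡ s → (r + s) % 4 ≡ 2 → Sum≡2Mod4 x y
  residues 0 2 _ _ x≡ y≡ _ = zero+two x≡ y≡
  residues 2 0 _ _ x≡ y≡ _ = two+zero x≡ y≡
  residues 1 1 _ _ x≡ y≡ _ = odd+odd (parity-%4 x x≡) (parity-%4 y y≡)
  residues 3 3 _ _ x≡ y≡ _ = odd+odd (parity-%4 x x≡) (parity-%4 y y≡)
  residues 0 0 _ _ _ _ ()
  residues 0 1 _ _ _ _ ()
  residues 0 3 _ _ _ _ ()
  residues 1 0 _ _ _ _ ()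
  residues 1 2 _ _ _ _ ()
  residues 1 3 _ _ _ _ ()
  residues 2 1 _ _ _ _ ()
  residues 2 2 _ _ _ _ ()
  residues 2 3 _ _ _ _ ()
  residues 3 0 _ _ _ _ ()
  residues 3 1 _ _ _ _ ()
  residues 3 2 _ _ _ _ ()
  residues (suc (suc (suc (suc _)))) _ (s≤s (s≤s (s≤s (s≤s ())))) _ _ _ _
  residues _ (suc (suc (suc (suc _)))) _ (s≤s (s≤s (s≤s (s≤s ())))) _ _ _

_≟ᵖ_ : DecidableEquality Parity
O ≟ᵖ O = yes refl
O ≟ᵖ E = no λ ()
E ≟ᵖ O = no λ ()
E ≟ᵖ E = yes refl

_≟ᶜ_ : DecidableEquality ParityClass
_≟ᶜ_ = ≡-dec _≟ᵖ_ (≡-dec _≟ᵖ_ (≡-dec _≟ᵖ_ _≟ᵖ_))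

open import Data.List.Membership.DecPropositional _≟ᶜ_ using (_∈?_)

allowed : ∀ {c} → True (c ∈? allowedClasses) → c ∈ allowedClasses
allowed = toWitness

OneEven-NotBothOdd-allowed : ∀ {a b c d} → OneEven a b → NotBothOdd c d → (a , b , c , d) ∈ allowedClasses
OneEven-NotBothOdd-allowed oddEven (oneEven oddEven) = allowed _
OneEven-NotBothOdd-allowed oddEven (oneEven evenOdd) = allowed _
OneEven-NotBothOdd-allowed oddEven bothEven          = allowed _
OneEven-NotBothOdd-allowed evenOdd (oneEven oddEven) = allowed _
OneEven-NotBothOdd-allowed evenOdd (oneEven evenOdd) = allowed _
OneEven-NotBothOdd-allowed evenOdd bothEven          = allowed _

NotBothOdd-OneEven-allowed : ∀ {a b c d} → NotBothOdd a b → OneEven c d → (a , b , c , d) ∈ allowedClasses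
NotBothOdd-OneEven-allowed (oneEven oddEven) oddEven = allowed _
NotBothOdd-OneEven-allowed (oneEven evenOdd) oddEven = allowed _
NotBothOdd-OneEven-allowed bothEven          oddEven = allowed _
NotBothOdd-OneEven-allowed (oneEven oddEven) evenOdd = allowed _
NotBothOdd-OneEven-allowed (oneEven evenOdd) evenOdd = allowed _
NotBothOdd-OneEven-allowed bothEven          evenOdd = allowed _

odd-products⇒OOOO : ∀ a b c d → parity (a * b) ≡ O → parity (c * d) ≡ O →
  (parity a , parity b , parity c , parity d) ≡ (O , O , O , O)
odd-products⇒OOOO a b c d ab-odd cd-odd
  with odd-product⇒odd-factors a b ab-odd | odd-product⇒odd-factors c d cd-odd
... | a-odd , b-odd | c-odd , d-odd =
  cong₂ _,_ a-odd (cong₂ _,_ b-odd (cong₂ _,_ c-odd d-odd))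

lemma3p1 : (N : ℕ) → N % 4 ≡ 2 → (p : TwoPartPartition) → size p ≡ N →
    (parityClass p ∈ allowedClasses)
    × (parityClass p ≢ (O , O , O , O) →
        ((l₁ p * m₁ p) % 4 ≡ 2 × (l₂ p * m₂ p) % 4 ≡ 0)
        ⊎ ((l₁ p * m₁ p) % 4 ≡ 0 × (l₂ p * m₂ p) % 4 ≡ 2))
lemma3p1 _ N%4≡2 (twoPart l₁ m₁ l₂ m₂ _ _ _ _) refl with sum≡2Mod4 (l₁ * m₁) (l₂ * m₂) N%4≡2
... | two+zero x≡2 y≡0 =
  OneEven-NotBothOdd-allowed (m*n%4≡2⇒OneEven l₁ m₁ x≡2) (m*n%4≡0⇒NotBothOdd l₂ m₂ y≡0) ,
  λ _ → inj₁ (x≡2 , y≡0)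
... | zero+two x≡0 y≡2 =
  NotBothOdd-OneEven-allowed (m*n%4≡0⇒NotBothOdd l₁ m₁ x≡0) (m*n%4≡2⇒OneEven l₂ m₂ y≡2) ,
  λ _ → inj₂ (x≡0 , y≡2)
... | odd+odd x-odd y-odd =
  subst (_∈ allowedClasses) (sym OOOO) (here refl) , contradiction OOOO
  where
  OOOO : (parity l₁ , parity m₁ , parity l₂ , parity m₂) ≡ (O , O , O , O)
  OOOO = odd-products⇒OOOO l₁ m₁ l₂ m₂ x-odd y-odd
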